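{- For every small bipointed type $A$, there is an equivalence of types $\mathsf{isind}(A)\simeq\mathsf{ishinit}(A)$.
   Context: Work in the intensional Martin-Löf type theory $\mathcal{H}$ with $\Sigma$-types, $\Pi$-types (with judgemental $\eta$), identity types, a universe $\mathsf{U}$ closed under $\Sigma,\Pi,\mathsf{Id}$, and function extensionality; no UIP. $\mathsf{iscontr}(X):=(\Sigma x:X)(\Pi y:X)\mathsf{Id}(x,y)$; $X\simeq Y$ means there is a function whose homotopy fibers are all contractible. $\mathsf{Bip}:=(\Sigma A:\mathsf{U})(A\times A)$, elements $(A,a_0,a_1)$. $\mathsf{Bip}(A,B):=(\Sigma f:A\to B)(\mathsf{Id}(fa_0,b_0)\times\mathsf{Id}(fa_1,b_1))$; $\mathsf{ishinit}(A):=(\Pi B:\mathsf{Bip})\mathsf{iscontr}(\mathsf{Bip}(A,B))$. $\mathsf{FibBip}(A):=(\Sigma E:A\to\mathsf{U})(E(a_0)\times E(a_1))$; for $(E,e_0,e_1)$ in it, $\mathsf{BipSec}(A,E):=(\Sigma f:(\Pi x:A)E(x))(\mathsf{Id}(fa_0,e_0)\times\mathsf{Id}(fa_1,e_1))$. $\mathsf{isind}(A):=(\Pi E:\mathsf{FibBip}(A))\mathsf{BipSec}(A,E)$. -}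

module Defs where

open import Level using (Level; _⊔_; Setω)
open import Data.Product using (Σ; _×_; _,_; proj₁; proj₂)
open import Relation.Binary.PropositionalEquality using (_≡_)
open import Axiom.Extensionality.Propositional using (Extensionality)

-- Ambient function extensionality of the type theory H (at all universe levels).
FunExt : Setω
FunExt = ∀ {a b} → Extensionality a b

iscontr : ∀ {ℓ} → Set ℓ → Set ℓ
iscontr X = Σ X λ x → (y : X) → x ≡ y

hfiber : ∀ {ℓ ℓ'} {X : Set ℓ} {Y : Set ℓ'} → (X → Y) → Y → Set (ℓ ⊔ ℓ')
hfiber {X = X} f y = Σ X λ x → f x ≡ y

isEquiv : ∀ {ℓ ℓ'} {X : Set ℓ} {Y : Set ℓ'} → (X → Y) → Set (ℓ ⊔ ℓ')
isEquiv {Y = Y} f = (y : Y) → iscontr (hfiber f y)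

_≃_ : ∀ {ℓ ℓ'} → Set ℓ → Set ℓ' → Set (ℓ ⊔ ℓ')
X ≃ Y = Σ (X → Y) isEquiv

-- bipointed types (U = Set)
Bip : Set₁
Bip = Σ Set λ A → A × A

BipHom : Bip → Bip → Set
BipHom (A , a₀ , a₁) (B , b₀ , b₁) =
  Σ (A → B) λ f → (f a₀ ≡ b₀) × (f a₁ ≡ b₁)

ishinit : Bip → Set₁
ishinit A = (B : Bip) → iscontr (BipHom A B)

FibBip : Bip → Set₁
FibBip (A , a₀ , a₁) = Σ (A → Set) λ E → E a₀ × E a₁

BipSec : (A : Bip) → FibBip A → Set
BipSec (A , a₀ , a₁) (E , e₀ , e₁) =
  Σ ((x : A) → E x) λ f → (f a₀ ≡ e₀) × (f a₁ ≡ e₁)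

isind : Bip → Set₁
isind A = (E : FibBip A) → BipSec A E

-- Both sides are propositions, so logical equivalence suffices. A homotopy-initial A is
-- inductive: the initial map into the total space Σ A E is a section of E once its
-- composite with the projection is identified with the identity, which initiality forces.
-- Conversely, induction into the family of pointwise identity types shows that bipointed
-- sections are unique, so inductive types have contractible section types; with a constant
-- family this is homotopy initiality, and since isind A is a product of section types it
-- is contractible as soon as it is inhabited.
module Submission where

open import Data.Product using (Σ; _×_; _,_; proj₁; proj₂)
open import Data.Product.Properties using (Σ-≡,≡←≡)
open import Function using (id; _∘_)
open import Relation.Binary.PropositionalEquality
open import Relation.Binary.PropositionalEquality.Properties using (trans-reflʳ)
open import Relation.Nullary.Irrelevant using (Irrelevant)
open import Axiom.UniquenessOfIdentityProofs using (UIP; module Constant⇒UIP)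
open import Defs

iscontr⇒Irrelevant : ∀ {ℓ} {X : Set ℓ} → iscontr X → Irrelevant X
iscontr⇒Irrelevant (c , h) x y = trans (sym (h x)) (h y)

Irrelevant⇒UIP : ∀ {ℓ} {X : Set ℓ} → Irrelevant X → UIP X
Irrelevant⇒UIP irr = Constant⇒UIP.≡-irrelevant
  (λ {x} {y} _ → trans (sym (irr x x)) (irr x y)) (λ _ _ → refl)

proj₁-injective : ∀ {a b} {X : Set a} {B : X → Set b} → (∀ x → Irrelevant (B x))
                → {u v : Σ X B} → proj₁ u ≡ proj₁ v → u ≡ v
proj₁-injective irr {x , b} {.x , b'} refl = cong (x ,_) (irr x b b')

Π-Irrelevant : ∀ {a b} → FunExt → {X : Set a} {B : X → Set b}
             → (∀ x → Irrelevant (B x)) → Irrelevant ((x : X) → B x)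
Π-Irrelevant fe irr f g = fe λ x → irr x (f x) (g x)

Π-iscontr : ∀ {a b} → FunExt → {X : Set a} {B : X → Set b}
          → (∀ x → iscontr (B x)) → iscontr ((x : X) → B x)
Π-iscontr fe c = (proj₁ ∘ c) , λ f → fe λ x → proj₂ (c x) (f x)

iscontr-Irrelevant : ∀ {ℓ} → FunExt → {X : Set ℓ} → Irrelevant (iscontr X)
iscontr-Irrelevant fe (c , h) (c' , h') =
  proj₁-injective (λ x k k' → fe λ y → Irrelevant⇒UIP (iscontr⇒Irrelevant (c , h)) (k y) (k' y))
                  (h c')

singleton-iscontr : ∀ {ℓ} {X : Set ℓ} (x : X) → iscontr (Σ X (x ≡_))
singleton-iscontr x = (x , refl) , λ { (y , refl) → refl }

-- This is what makes homotopy induction available although FunExt need not compute on refl.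
homotopies-iscontr : ∀ {a b} → FunExt → {X : Set a} {B : X → Set b} (f : (x : X) → B x)
                   → iscontr (Σ ((x : X) → B x) λ g → ∀ x → f x ≡ g x)
homotopies-iscontr fe {X} {B} f = unzip centre , λ y → cong unzip (contraction (zip y))
  where
  Pointwise = (x : X) → Σ (B x) (f x ≡_)
  centre = proj₁ (Π-iscontr fe (singleton-iscontr ∘ f))
  contraction = proj₂ (Π-iscontr fe (singleton-iscontr ∘ f))
  unzip : Pointwise → Σ ((x : X) → B x) λ g → ∀ x → f x ≡ g x
  unzip k = proj₁ ∘ k , proj₂ ∘ k
  zip : Σ ((x : X) → B x) (λ g → ∀ x → f x ≡ g x) → Pointwise
  zip (g , h) x = g x , h x

homotopy-ind : ∀ {a b ℓ} → FunExt → {X : Set a} {B : X → Set b} (f : (x : X) → B x)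
             (P : (g : (x : X) → B x) → (∀ x → f x ≡ g x) → Set ℓ)
             → P f (λ _ → refl) → ∀ g h → P g h
homotopy-ind fe f P P-refl g h =
  subst (λ (g , h) → P g h)
        (iscontr⇒Irrelevant (homotopies-iscontr fe f) (f , λ _ → refl) (g , h)) P-refl

Irrelevant-⇔⇒≃ : ∀ {a b} {X : Set a} {Y : Set b} → Irrelevant X → Irrelevant Y
               → (X → Y) → (Y → X) → X ≃ Y
Irrelevant-⇔⇒≃ irrX irrY to from = to , λ y →
  (from y , irrY _ _) ,
  λ (x , _) → proj₁-injective (λ _ → Irrelevant⇒UIP irrY) (irrX (from y) x)

refl≡trans-sym⇒≡ : ∀ {ℓ} {X : Set ℓ} {x y : X} (p q : x ≡ y) → refl ≡ trans p (sym q) → p ≡ q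
refl≡trans-sym⇒≡ p refl e = trans (sym (trans-reflʳ p)) (sym e)

Agreement : (A : Bip) (E : FibBip A) → BipSec A E → BipSec A E → FibBip A
Agreement (A , a₀ , a₁) (E , e₀ , e₁) (f , p₀ , p₁) (g , q₀ , q₁) =
  (λ x → f x ≡ g x) , trans p₀ (sym q₀) , trans p₁ (sym q₁)

BipSec-≡ : FunExt → (A : Bip) (E : FibBip A) (s t : BipSec A E)
         → BipSec A (Agreement A E s t) → s ≡ t
BipSec-≡ fe (A , a₀ , a₁) (E , e₀ , e₁) (f , p₀ , p₁) (g , q₀ , q₁) (h , h₀ , h₁) =
  homotopy-ind fe f P P-refl g h q₀ q₁ h₀ h₁
  where
  P : (g : (x : A) → E x) → (∀ x → f x ≡ g x) → Set
  P g h = (q₀ : g a₀ ≡ e₀) (q₁ : g a₁ ≡ e₁)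
        → h a₀ ≡ trans p₀ (sym q₀) → h a₁ ≡ trans p₁ (sym q₁)
        → _≡_ {A = BipSec (A , a₀ , a₁) (E , e₀ , e₁)} (f , p₀ , p₁) (g , q₀ , q₁)
  P-refl : P f (λ _ → refl)
  P-refl q₀ q₁ h₀ h₁ =
    cong (f ,_) (cong₂ _,_ (refl≡trans-sym⇒≡ p₀ q₀ h₀) (refl≡trans-sym⇒≡ p₁ q₁ h₁))

isind⇒BipSec-iscontr : FunExt → (A : Bip) → isind A → (E : FibBip A) → iscontr (BipSec A E)
isind⇒BipSec-iscontr fe A ind E =
  ind E , λ t → BipSec-≡ fe A E (ind E) t (ind (Agreement A E (ind E) t))

isind-Irrelevant : FunExt → (A : Bip) → Irrelevant (isind A)
isind-Irrelevant fe A ind = iscontr⇒Irrelevant (Π-iscontr fe (isind⇒BipSec-iscontr fe A ind)) ind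

ishinit-Irrelevant : FunExt → (A : Bip) → Irrelevant (ishinit A)
ishinit-Irrelevant fe A = Π-Irrelevant fe λ _ → iscontr-Irrelevant fe

isind⇒ishinit : FunExt → (A : Bip) → isind A → ishinit A
isind⇒ishinit fe A ind (B , b₀ , b₁) = isind⇒BipSec-iscontr fe A ind ((λ _ → B) , b₀ , b₁)

Total : (A : Bip) → FibBip A → Bip
Total (A , a₀ , a₁) (E , e₀ , e₁) = Σ A E , (a₀ , e₀) , (a₁ , e₁)

idBip : (A : Bip) → BipHom A A
idBip A = id , refl , refl

-- Sections of E along an endomorphism φ of A; along idBip A this is BipSec A E on the nose.
BipSecAlong : (A : Bip) → FibBip A → BipHom A A → Set
BipSecAlong (A , a₀ , a₁) (E , e₀ , e₁) (φ , c₀ , c₁) =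
  Σ ((x : A) → E (φ x)) λ s → (subst E c₀ (s a₀) ≡ e₀) × (subst E c₁ (s a₁) ≡ e₁)

BipHom-Total⇒BipSecAlong : (A : Bip) (E : FibBip A) (g : BipHom A (Total A E))
                         → Σ (BipHom A A) (BipSecAlong A E)
BipHom-Total⇒BipSecAlong (A , a₀ , a₁) (E , e₀ , e₁) (g , r₀ , r₁) =
  (proj₁ ∘ g , proj₁ (Σ-≡,≡←≡ r₀) , proj₁ (Σ-≡,≡←≡ r₁)) ,
  (proj₂ ∘ g , proj₂ (Σ-≡,≡←≡ r₀) , proj₂ (Σ-≡,≡←≡ r₁))

ishinit⇒isind : (A : Bip) → ishinit A → isind A
ishinit⇒isind A hinit E =
  let φ , s = BipHom-Total⇒BipSecAlong A E (proj₁ (hinit (Total A E)))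
  in subst (BipSecAlong A E) (iscontr⇒Irrelevant (hinit A) φ (idBip A)) s

corollary3p11 : FunExt → (A : Bip) → isind A ≃ ishinit A
corollary3p11 fe A =
  Irrelevant-⇔⇒≃ (isind-Irrelevant fe A) (ishinit-Irrelevant fe A)
                 (isind⇒ishinit fe A) (ishinit⇒isind A)
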